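{- Let $n_1,\dots,n_m$ be even integers with $n_i\ge 4$, and let $\mathcal{C}=\mathcal{C}(C_{n_1},\dots,C_{n_m})$ be the chain cycle obtained by identifying $v^i_{\frac{n_i}{2}+1}$ with $v^{i+1}_1$ for each $i=1,\dots,m-1$. Then $sdim(\mathcal{C})=1+\sum_{i=1}^{m}\frac{n_i-2}{2}$.
   Context: The cycles $C_{n_1},\dots,C_{n_m}$ are pairwise disjoint, $V(C_{n_i})=\{v^i_1,\dots,v^i_{n_i}\}$ with $v^i_j$ adjacent to $v^i_{j+1}$ ($1\le j<n_i$) and $v^i_{n_i}$ adjacent to $v^i_1$; the chain cycle is obtained from their disjoint union by the stated identifications. A vertex $w$ strongly resolves distinct vertices $u,v$ of a connected graph $G$ if $u$ lies on a shortest $v$–$w$ path or $v$ lies on a shortest $u$–$w$ path. A set $W\subseteq V(G)$ is a strong resolving set if every pair of distinct vertices is strongly resolved by some $w\in W$. The strong metric dimension $sdim(G)$ is the minimum cardinality of a strong resolving set. -}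

module Defs where

open import Level using (0ℓ)
open import Data.Nat using (ℕ; zero; suc; _+_; _∸_; _/_; _≤_; _<_)
open import Data.Fin using (Fin; toℕ)
open import Data.List using (List; []; _∷_; length)
open import Data.List.Membership.Propositional using (_∈_)
open import Data.List.Relation.Unary.Unique.Propositional using (Unique)
open import Data.Product using (Σ; ∃; ∃-syntax; _×_; _,_)
open import Data.Sum using (_⊎_)
open import Relation.Binary.PropositionalEquality using (_≡_; _≢_)

record Graph : Set₁ where
  field
    V   : Set
    Adj : V → V → Set
open Graph public

module _ (G : Graph) where

  data Walk : V G → V G → Set where
    [_]   : (x : V G) → Walk x x
    _∷ʷ_  : {x y z : V G} → Adj G x y → Walk y z → Walk x z

  len : {x y : V G} → Walk x y → ℕ
  len [ x ]      = zero
  len (e ∷ʷ p)   = suc (len p)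

  data OnWalk (u : V G) : {x y : V G} → Walk x y → Set where
    here-end : OnWalk u [ u ]
    here     : {y z : V G} (e : Adj G u y) (p : Walk y z) → OnWalk u (e ∷ʷ p)
    there    : {x y z : V G} (e : Adj G x y) {p : Walk y z} → OnWalk u p → OnWalk u (e ∷ʷ p)

  -- a shortest x–y walk (hence a shortest x–y path)
  IsShortest : {x y : V G} → Walk x y → Set
  IsShortest {x} {y} p = (q : Walk x y) → len p ≤ len q

  OnShortestPath : V G → V G → V G → Set
  OnShortestPath u a b = Σ (Walk a b) λ p → IsShortest p × OnWalk u p

  StronglyResolves : V G → V G → V G → Set
  StronglyResolves w u v = OnShortestPath u v w ⊎ OnShortestPath v u w

  IsStrongResolvingSet : List (V G) → Set
  IsStrongResolvingSet W =
    (u v : V G) → u ≢ v → Σ (V G) λ w → w ∈ W × StronglyResolves w u v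

  IsSDim : ℕ → Set
  IsSDim d =
    (Σ (List (V G)) λ W → Unique W × IsStrongResolvingSet W × length W ≡ d)
    × ((W : List (V G)) → Unique W → IsStrongResolvingSet W → d ≤ length W)

-- Indices are 0-based: cycle i : Fin m is C_{n_{i+1}}, raw position
-- a < n i on it is v^{i+1}_{a+1}.  Identification: raw (i+1, 0)
-- (= v^{i+2}_1) equals raw (i, n i / 2) (= v^{i+1}_{n_{i+1}/2+1}).
-- Canonical representatives: `base` = raw (0,0); `node i j` = raw (i, j+1).
-- The raw vertex (i+1, 0) is represented by node i j with j+1 = n i / 2.

data CCV (m : ℕ) (n : Fin m → ℕ) : Set where
  base : CCV m n
  node : (i : Fin m) → Fin (n i ∸ 1) → CCV m n

-- Named x i a : vertex x is (the class of) raw vertex (i , a)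
Named : {m : ℕ} {n : Fin m → ℕ} → CCV m n → Fin m → ℕ → Set
Named base i a = toℕ i ≡ 0 × a ≡ 0
Named {n = n} (node i j) i' a =
  (i ≡ i' × a ≡ suc (toℕ j))
  ⊎ (toℕ i' ≡ suc (toℕ i) × a ≡ 0 × suc (toℕ j) ≡ n i / 2)

CycAdj : ℕ → ℕ → ℕ → Set
CycAdj N a b =
  (suc a ≡ b) ⊎ (suc b ≡ a) ⊎ (suc a ≡ N × b ≡ 0) ⊎ (suc b ≡ N × a ≡ 0)

ChainCycle : (m : ℕ) → (Fin m → ℕ) → Graph
ChainCycle m n = record
  { V   = CCV m n
  ; Adj = λ x y → Σ (Fin m) λ i → Σ ℕ λ a → Σ ℕ λ b →
            Named x i a × Named y i b × a < n i × b < n i × CycAdj (n i) a b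
  }

module Submission where

-- The chain cycle is identified with
-- an explicit coordinate model (Model): cut vertices `cut c` at height offset c,
-- and on cycle c the inner vertices `up c t` / `dn c t` of its two arcs.  The
-- model carries a closed-form distance: the shorter way round the cycle for
-- vertices on opposite arcs of one cycle, the height difference otherwise.  A
-- general lemma (Geodesics) shows that any function vanishing only on the
-- diagonal, changing by at most one along an edge and decreasable along some
-- edge is the graph distance, so "u lies on a shortest v–w path" becomes an
-- identity between closed-form distances.
-- Upper bound (Basis): the bottom vertex together with all inner vertices of the
-- upper arcs separates every pair.  Lower bound: each basis vertex and its
-- partner (its antipode, or the top vertex) are mutually maximally distant, so
-- every strong resolving set meets the pair; distinct pairs lie at distinct
-- heights, which bounds the size of the set from below.

open import Defs
open import Data.Nat using (ℕ; _+_; _∸_; _/_; _≤_)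
open import Data.Nat.Divisibility using (_∣_)
open import Data.Fin using (Fin)
open import Data.List using (tabulate)
open import Data.Nat.ListAction using (sum)

open import Data.Nat
open import Data.Nat.Properties
open import Data.Nat.DivMod using (m/n*n≡m; m*n/n≡m)
open import Data.Fin using (toℕ; fromℕ<)
open import Data.Fin.Properties using (toℕ-injective; toℕ<n; fromℕ<-toℕ; toℕ-fromℕ<)
open import Data.Product using (Σ; _×_; _,_; proj₁; proj₂)
open import Data.Sum using (_⊎_; inj₁; inj₂) renaming (map to ⊎-map)
open import Data.Empty using (⊥-elim)
open import Data.List using (List; []; _∷_; _++_; map; concat; length; upTo)
open import Data.List.Properties using (length-++; length-map; length-upTo; map-tabulate; tabulate-cong)
open import Data.List.Relation.Unary.All as All using (All; []; _∷_)
import Data.List.Relation.Unary.All.Properties as AllP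
open import Data.List.Relation.Unary.AllPairs using ([]; _∷_)
import Data.List.Relation.Unary.AllPairs.Properties as AllPairsP
open import Data.List.Relation.Unary.Any using (here; there)
open import Data.List.Relation.Unary.Unique.Propositional using (Unique)
import Data.List.Relation.Unary.Unique.Propositional.Properties as UniqueP
open import Data.List.Membership.Propositional using (_∈_; mapWith∈)
open import Data.List.Membership.Propositional.Properties
  using (∈-map⁺; ∈-map⁻; ∈-∃++; ∈-++⁻; ∈-++⁺ˡ; ∈-++⁺ʳ; ∈-concat⁺′; ∈-concat⁻′; ∈-tabulate⁺; ∈-tabulate⁻;
         ∈-upTo⁺; ∈-upTo⁻; mapWith∈-cong; mapWith∈-id; map-mapWith∈)
open import Function using (_∘_)
open import Relation.Nullary using (¬_; Dec; yes; no)
open import Relation.Binary.PropositionalEquality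
open import Relation.Binary.Definitions using (Tri; tri<; tri≈; tri>)

module WalkFacts (G : Graph) where

  _++ʷ_ : ∀ {x y z} → Walk G x y → Walk G y z → Walk G x z
  [ _ ]    ++ʷ q = q
  (e ∷ʷ p) ++ʷ q = e ∷ʷ (p ++ʷ q)

  len-++ʷ : ∀ {x y z} (p : Walk G x y) (q : Walk G y z) →
            len G (p ++ʷ q) ≡ len G p + len G q
  len-++ʷ [ _ ]    q = refl
  len-++ʷ (e ∷ʷ p) q = cong suc (len-++ʷ p q)

  junction-on-++ʷ : ∀ {x y z} (p : Walk G x y) (q : Walk G y z) → OnWalk G y (p ++ʷ q)
  junction-on-++ʷ [ _ ]    [ _ ]    = here-end
  junction-on-++ʷ [ _ ]    (e ∷ʷ q) = here e q
  junction-on-++ʷ (e ∷ʷ p) q        = there e (junction-on-++ʷ p q)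

  split-at : ∀ {u x y} (p : Walk G x y) → OnWalk G u p →
             Σ (Walk G x u) λ p₁ → Σ (Walk G u y) λ p₂ → len G p₁ + len G p₂ ≡ len G p
  split-at [ u ]    here-end       = [ u ] , [ u ] , refl
  split-at {u} (e ∷ʷ p) (here .e .p) = [ u ] , (e ∷ʷ p) , refl
  split-at (e ∷ʷ p) (there .e o) with split-at p o
  ... | p₁ , p₂ , eq = (e ∷ʷ p₁) , p₂ , cong suc eq

-- A distance certificate for G: a function δ which vanishes exactly on the
-- diagonal, grows by at most one along an edge, and can always be decreased by
-- one along some edge.  Such a δ is the graph distance, so shortest paths and
-- strong resolution can be read off from it.
module Geodesics (G : Graph) (δ : V G → V G → ℕ)
  (δ-refl    : ∀ x → δ x x ≡ 0)
  (δ-zero    : ∀ x y → δ x y ≡ 0 → x ≡ y)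
  (δ-step    : ∀ {x y} z → Adj G x y → δ x z ≤ suc (δ y z))
  (δ-descent : ∀ x z k → δ x z ≡ suc k → Σ (V G) λ y → Adj G x y × δ y z ≡ k)
  where

  open WalkFacts G

  δ≤len : ∀ {x y} (p : Walk G x y) → δ x y ≤ len G p
  δ≤len {x} [ x ]        = ≤-reflexive (δ-refl x)
  δ≤len {x} {z} (e ∷ʷ p) = ≤-trans (δ-step z e) (s≤s (δ≤len p))

  geodesic : ∀ k x y → δ x y ≡ k → Σ (Walk G x y) λ p → len G p ≡ k
  geodesic zero x y e with δ-zero x y e
  ... | refl = [ x ] , refl
  geodesic (suc k) x y e with δ-descent x y k e
  ... | x' , adj , e' with geodesic k x' y e'
  ...   | p , lp = (adj ∷ʷ p) , cong suc lp

  between⇒onShortest : ∀ u v w → δ v u + δ u w ≡ δ v w → OnShortestPath G u v w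
  between⇒onShortest u v w eq with geodesic _ v u refl | geodesic _ u w refl
  ... | p₁ , l₁ | p₂ , l₂ = (p₁ ++ʷ p₂) , shortest , junction-on-++ʷ p₁ p₂
    where
    shortest : IsShortest G (p₁ ++ʷ p₂)
    shortest q = ≤-trans (≤-reflexive (trans (len-++ʷ p₁ p₂) (trans (cong₂ _+_ l₁ l₂) eq))) (δ≤len q)

  onShortest⇒between : ∀ u v w → OnShortestPath G u v w → δ v u + δ u w ≤ δ v w
  onShortest⇒between u v w (P , shortest , onP) with split-at P onP | geodesic _ v w refl
  ... | p₁ , p₂ , eq | Q , lQ =
    ≤-trans (+-mono-≤ (δ≤len p₁) (δ≤len p₂)) (≤-trans (≤-reflexive eq) (≤-trans (shortest Q) (≤-reflexive lQ)))

  MutuallyMaximal : V G → V G → Set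
  MutuallyMaximal u v =
    (∀ w → δ v u + δ u w ≤ δ v w → w ≡ u) × (∀ w → δ u v + δ v w ≤ δ u w → w ≡ v)

  -- Only u and v themselves strongly resolve a mutually maximally distant pair,
  -- so every strong resolving set contains one of them.
  resolving-set-meets : ∀ {u v} W → MutuallyMaximal u v → u ≢ v →
                        IsStrongResolvingSet G W → u ∈ W ⊎ v ∈ W
  resolving-set-meets {u} {v} W (beyond-u , beyond-v) u≢v resolving with resolving u v u≢v
  ... | w , w∈W , inj₁ onS with beyond-u w (onShortest⇒between u v w onS)
  ...   | refl = inj₁ w∈W
  resolving-set-meets {u} {v} W (beyond-u , beyond-v) u≢v resolving
      | w , w∈W , inj₂ onS with beyond-v w (onShortest⇒between v u w onS)
  ...   | refl = inj₂ w∈W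

unique-length-≤ : ∀ {A : Set} (xs ys : List A) → Unique xs → (∀ {x} → x ∈ xs → x ∈ ys) → length xs ≤ length ys
unique-length-≤ []       ys _           _   = z≤n
unique-length-≤ (x ∷ xs) ys (x∉xs ∷ xs!) xs⊆ys with ∈-∃++ (xs⊆ys (here refl))
... | ys₁ , ys₂ , refl =
  ≤-trans (s≤s (unique-length-≤ xs (ys₁ ++ ys₂) xs! xs⊆ys₁++ys₂))
    (≤-reflexive (trans (cong suc (length-++ ys₁)) (trans (sym (+-suc (length ys₁) (length ys₂))) (sym (length-++ ys₁)))))
  where
  xs⊆ys₁++ys₂ : ∀ {z} → z ∈ xs → z ∈ ys₁ ++ ys₂
  xs⊆ys₁++ys₂ {z} z∈xs with ∈-++⁻ ys₁ (xs⊆ys (there z∈xs))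
  ... | inj₁ p           = ∈-++⁺ˡ p
  ... | inj₂ (here refl) = ⊥-elim (All.lookup x∉xs z∈xs refl)
  ... | inj₂ (there p)   = ∈-++⁺ʳ ys₁ p

unique-map-injectiveOn : ∀ {A B : Set} {P : A → Set} (f : A → B) {xs : List A} → All P xs →
  (∀ {x y} → P x → P y → f x ≡ f y → x ≡ y) → Unique xs → Unique (map f xs)
unique-map-injectiveOn f []         inj []          = []
unique-map-injectiveOn f (px ∷ pxs) inj (x∉ ∷ xs!) =
  All.tabulate (λ {y} y∈ fx≡y → let (z , z∈ , y≡fz) = ∈-map⁻ f y∈ in
                 All.lookup x∉ z∈ (inj px (All.lookup pxs z∈) (trans fx≡y y≡fz))) ∷
  unique-map-injectiveOn f pxs inj xs!

length-concat : ∀ {A : Set} (xss : List (List A)) → length (concat xss) ≡ sum (map length xss)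
length-concat []         = refl
length-concat (xs ∷ xss) = trans (length-++ xs) (cong (length xs +_) (length-concat xss))

∣suc-a-a∣≡1 : ∀ a → ∣ suc a - a ∣ ≡ 1
∣suc-a-a∣≡1 zero    = refl
∣suc-a-a∣≡1 (suc a) = ∣suc-a-a∣≡1 a

∣-∣-1-lipschitz : ∀ a z → ∣ a - z ∣ ≤ suc ∣ suc a - z ∣ × ∣ suc a - z ∣ ≤ suc ∣ a - z ∣
∣-∣-1-lipschitz a z =
  ≤-trans (∣-∣-triangle a (suc a) z) (≤-reflexive (cong (_+ ∣ suc a - z ∣) (trans (∣-∣-comm a (suc a)) (∣suc-a-a∣≡1 a)))) ,
  ≤-trans (∣-∣-triangle (suc a) a z) (≤-reflexive (cong (_+ ∣ a - z ∣) (∣suc-a-a∣≡1 a)))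

∣-∣-step-up : ∀ a z k → a < z → ∣ a - z ∣ ≡ suc k → ∣ suc a - z ∣ ≡ k
∣-∣-step-up zero    (suc z) k a<z       e = trans (∣-∣-identityˡ z) (cong pred e)
∣-∣-step-up (suc a) (suc z) k (s≤s a<z) e = ∣-∣-step-up a z k a<z e

∣-∣-step-down : ∀ a z k → z < suc a → ∣ suc a - z ∣ ≡ suc k → ∣ a - z ∣ ≡ k
∣-∣-step-down a       zero    k z<a       e = trans (∣-∣-identityʳ a) (cong pred e)
∣-∣-step-down (suc a) (suc z) k (s≤s z<a) e = ∣-∣-step-down a z k z<a e

∣-∣<bound : ∀ a b x → a < x → b < x → ∣ a - b ∣ < x
∣-∣<bound a b x a<x b<x = ≤-<-trans (∣m-n∣≤m⊔n a b) (⊔-lub a<x b<x)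

∣-∣-pos : ∀ a b → a ≢ b → 0 < ∣ a - b ∣
∣-∣-pos a b a≢b with ∣ a - b ∣ in eq
... | zero  = ⊥-elim (a≢b (∣m-n∣≡0⇒m≡n eq))
... | suc _ = s≤s z≤n

<∸1⇒suc< : ∀ {a y} → a < y ∸ 1 → suc a < y
<∸1⇒suc< {y = suc y} lt = s≤s lt

suc<⇒<∸1 : ∀ {a y} → suc a < y → a < y ∸ 1
suc<⇒<∸1 {y = suc y} (s≤s lt) = lt

∸-suc : ∀ x t → t < x → x ∸ t ≡ suc (x ∸ suc t)
∸-suc (suc x) zero    _        = refl
∸-suc (suc x) (suc t) (s≤s lt) = ∸-suc x t lt

∸-pos< : ∀ x t → 1 ≤ t → t < x → x ∸ t < x
∸-pos< x t 1≤t t<x = ∸-monoʳ-< {x} {t} {0} 1≤t (<⇒≤ t<x)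

⊓-1-lipschitz : ∀ A A' B B' → A' ≡ suc A → B ≡ suc B' →
                (A ⊓ B ≤ suc (A' ⊓ B')) × (A' ⊓ B' ≤ suc (A ⊓ B))
⊓-1-lipschitz A A' B B' refl refl =
  ⊓-glb (≤-trans (m⊓n≤m A (suc B')) (≤-trans (n≤1+n A) (n≤1+n (suc A)))) (m⊓n≤n A (suc B')) ,
  ⊓-glb (m⊓n≤m (suc A) B') (≤-trans (m⊓n≤n (suc A) B') (≤-trans (n≤1+n B') (n≤1+n (suc B'))))

⊓-descend-left : ∀ A A' B B' k → A ≡ suc A' → B' ≡ suc B → A ≤ B → A ⊓ B ≡ suc k → A' ⊓ B' ≡ k
⊓-descend-left A A' B B' k refl refl A≤B e =
  trans (m≤n⇒m⊓n≡m (≤-trans (n≤1+n A') (≤-trans A≤B (n≤1+n B)))) (cong pred (trans (sym (m≤n⇒m⊓n≡m A≤B)) e))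

⊓-descend-right : ∀ A A' B B' k → A' ≡ suc A → B ≡ suc B' → B ≤ A → A ⊓ B ≡ suc k → A' ⊓ B' ≡ k
⊓-descend-right A A' B B' k refl refl B≤A e =
  trans (m≥n⇒m⊓n≡n (≤-trans (n≤1+n B') (≤-trans B≤A (n≤1+n A)))) (cong pred (trans (sym (m≥n⇒m⊓n≡n B≤A)) e))

-- arc x a b is the distance between position a on one arc and position b on
-- the other arc of a cycle formed by two arcs of length x with common ends:
-- the shorter of the two ways round the cycle.
arc : ℕ → ℕ → ℕ → ℕ
arc x a b = (a + b) ⊓ ((x ∸ a) + (x ∸ b))

arc-comm : ∀ x a b → arc x a b ≡ arc x b a
arc-comm x a b = cong₂ _⊓_ (+-comm a b) (+-comm (x ∸ a) (x ∸ b))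

arc≤ : ∀ x a b → a ≤ x → b ≤ x → arc x a b ≤ x
arc≤ x a b a≤x b≤x with (a + b) ≤? x
... | yes le = ≤-trans (m⊓n≤m (a + b) _) le
... | no nle = ≤-trans (m⊓n≤n (a + b) _)
      (≤-trans (+-monoʳ-≤ (x ∸ a) (m≤n+o⇒m∸n≤o x b (≤-trans (<⇒≤ (≰⇒> nle)) (≤-reflexive (+-comm a b)))))
         (≤-reflexive (m∸n+n≡m a≤x)))

arc-antipodal : ∀ x t → t ≤ x → arc x t (x ∸ t) ≡ x
arc-antipodal x t t≤x rewrite m+[n∸m]≡n t≤x | m∸[m∸n]≡n t≤x | m∸n+n≡m t≤x = ⊓-idem x

-- Going from position b on the lower arc through position a on the upper arc
-- to the antipode x ∸ b of b is a shortest route.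
arc-through : ∀ x a b → a < x → b < x → arc x b a + ∣ a - (x ∸ b) ∣ ≡ x
arc-through x a b a<x b<x with ≤-total a (x ∸ b)
... | inj₁ le = trans (cong₂ _+_ (trans (arc-comm x b a) (m≤n⇒m⊓n≡m short)) (m≤n⇒∣m-n∣≡n∸m le))
                  (trans (trans (cong (_+ (y ∸ a)) (+-comm a b)) (+-assoc b a (y ∸ a)))
                    (trans (cong (b +_) (m+[n∸m]≡n le)) (m+[n∸m]≡n (<⇒≤ b<x))))
  where
  y = x ∸ b
  x∸a≡ : x ∸ a ≡ b + (y ∸ a)
  x∸a≡ = trans (cong (_∸ a) (sym (m+[n∸m]≡n (<⇒≤ b<x)))) (+-∸-assoc b le)
  short : a + b ≤ (x ∸ a) + y
  short = ≤-trans (≤-reflexive (+-comm a b)) (≤-trans (+-monoʳ-≤ b le)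
            (≤-trans (+-monoˡ-≤ y (m≤m+n b (y ∸ a))) (≤-reflexive (cong (_+ y) (sym x∸a≡)))))
... | inj₂ le = trans (cong₂ _+_ (trans (arc-comm x b a) (m≥n⇒m⊓n≡n long)) (m≤n⇒∣n-m∣≡n∸m le))
                  (trans (+-assoc (x ∸ a) y (a ∸ y))
                    (trans (cong ((x ∸ a) +_) (m+[n∸m]≡n le)) (m∸n+n≡m (<⇒≤ a<x))))
  where
  y = x ∸ b
  long : (x ∸ a) + y ≤ a + b
  long = ≤-trans (+-mono-≤ (m≤n+o⇒m∸n≤o x a (≤-trans (≤-reflexive (sym (m+[n∸m]≡n (<⇒≤ b<x))))
                   (≤-trans (+-monoʳ-≤ b le) (≤-reflexive (+-comm b a))))) le)
           (≤-reflexive (+-comm b a))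

arc-from-start : ∀ x b → b < x → b ≤ suc (arc x 1 b) × arc x 1 b ≤ suc b
arc-from-start x b b<x =
  ⊓-glb (≤-trans (n≤1+n b) (n≤1+n (suc b)))
        (≤-trans (≤-trans (<⇒≤pred b<x) (≤-reflexive (sym (pred-is-∸1 x)))) (≤-trans (m≤m+n (x ∸ 1) (x ∸ b)) (n≤1+n _))) ,
  m⊓n≤m (suc b) _
  where
  pred-is-∸1 : ∀ x → x ∸ 1 ≡ pred x
  pred-is-∸1 zero    = refl
  pred-is-∸1 (suc x) = refl

arc-from-end : ∀ x t b → suc t ≡ x → b < x → arc x t b ≤ suc (x ∸ b) × x ∸ b ≤ suc (arc x t b)
arc-from-end .(suc t) t b refl b<x =
  ≤-trans (m⊓n≤n (t + b) _) (≤-reflexive (cong (_+ (suc t ∸ b)) (trans (cong (_∸ t) (+-comm 1 t)) (m+n∸m≡n t 1)))) ,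
  ⊓-glb (≤-trans (m∸n≤m (suc t) b) (s≤s (m≤m+n t b))) (≤-trans (m≤n+m (suc t ∸ b) (suc t ∸ t)) (n≤1+n _))

-- The coordinate model of a chain of m cycles, cycle c having two arcs of
-- h c edges each.  Cycle c runs from the cut vertex `cut c` (height offset c)
-- to `cut (suc c)` (height offset (suc c)); its inner vertices are `up c t`
-- and `dn c t` (1 ≤ t < h c), both at height offset c + t.
module Model (m : ℕ) (h : ℕ → ℕ) (h≥2 : ∀ c → c < m → 2 ≤ h c) where

  offset : ℕ → ℕ
  offset zero    = 0
  offset (suc c) = offset c + h c

  data Pt : Set where
    cut   : ℕ → Pt
    up dn : ℕ → ℕ → Pt

  height : Pt → ℕ
  height (cut c)  = offset c
  height (up c t) = offset c + t
  height (dn c t) = offset c + t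

  Valid : Pt → Set
  Valid (cut c)  = c ≤ m
  Valid (up c t) = c < m × 1 ≤ t × t < h c
  Valid (dn c t) = c < m × 1 ≤ t × t < h c

  data Opposite : Pt → Pt → Set where
    up-dn : ∀ {c t t'} → Opposite (up c t) (dn c t')
    dn-up : ∀ {c t t'} → Opposite (dn c t) (up c t')

  opposite-irrelevant : ∀ {p q} (o o' : Opposite p q) → o ≡ o'
  opposite-irrelevant up-dn up-dn = refl
  opposite-irrelevant dn-up dn-up = refl

  opposite-sym : ∀ {p q} → Opposite p q → Opposite q p
  opposite-sym up-dn = dn-up
  opposite-sym dn-up = up-dn

  opposite? : ∀ p q → Dec (Opposite p q)
  opposite? (cut _)  _          = no λ ()
  opposite? (up c t) (cut _)    = no λ ()
  opposite? (up c t) (up _ _)   = no λ ()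
  opposite? (up c t) (dn c' t') with c ≟ c'
  ... | yes refl = yes up-dn
  ... | no c≢c'  = no λ { up-dn → c≢c' refl }
  opposite? (dn c t) (cut _)    = no λ ()
  opposite? (dn c t) (dn _ _)   = no λ ()
  opposite? (dn c t) (up c' t') with c ≟ c'
  ... | yes refl = yes dn-up
  ... | no c≢c'  = no λ { dn-up → c≢c' refl }

  oppositeDist : ∀ {p q} → Opposite p q → ℕ
  oppositeDist (up-dn {c} {t} {t'}) = arc (h c) t t'
  oppositeDist (dn-up {c} {t} {t'}) = arc (h c) t t'

  distWith : (p q : Pt) → Dec (Opposite p q) → ℕ
  distWith p q (yes o) = oppositeDist o
  distWith p q (no _)  = ∣ height p - height q ∣

  dist : Pt → Pt → ℕ
  dist p q = distWith p q (opposite? p q)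

  -- Case split on oppositeness that leaves occurrences of dist untouched.
  opposite-or-not : ∀ p q → Opposite p q ⊎ ¬ Opposite p q
  opposite-or-not p q with opposite? p q
  ... | yes o = inj₁ o
  ... | no ¬o = inj₂ ¬o

  dist-opp : ∀ {p q} (o : Opposite p q) → dist p q ≡ oppositeDist o
  dist-opp {p} {q} o with opposite? p q
  ... | yes o' = cong oppositeDist (opposite-irrelevant o' o)
  ... | no ¬o  = ⊥-elim (¬o o)

  dist-no : ∀ {p q} → ¬ Opposite p q → dist p q ≡ ∣ height p - height q ∣
  dist-no {p} {q} ¬o with opposite? p q
  ... | yes o = ⊥-elim (¬o o)
  ... | no _  = refl

  dist-refl : ∀ p → dist p p ≡ 0
  dist-refl p = trans (dist-no {p} {p} λ ()) (∣n-n∣≡0 (height p))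

  -- Reflection exchanging the two arcs of every cycle preserves everything.
  mirror : Pt → Pt
  mirror (cut c)  = cut c
  mirror (up c t) = dn c t
  mirror (dn c t) = up c t

  mirror-involutive : ∀ p → mirror (mirror p) ≡ p
  mirror-involutive (cut c)  = refl
  mirror-involutive (up c t) = refl
  mirror-involutive (dn c t) = refl

  valid-mirror : ∀ p → Valid p → Valid (mirror p)
  valid-mirror (cut c)  v = v
  valid-mirror (up c t) v = v
  valid-mirror (dn c t) v = v

  opposite-mirror : ∀ {p q} → Opposite (mirror p) (mirror q) → Opposite p q
  opposite-mirror {up c t} {dn c' t'} dn-up = up-dn
  opposite-mirror {dn c t} {up c' t'} up-dn = dn-up

  dist-mirror : ∀ p q → dist (mirror p) (mirror q) ≡ dist p q
  dist-mirror p q with opposite? p q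
  ... | yes (up-dn {c} {t} {t'}) = dist-opp {dn c t} {up c t'} dn-up
  ... | yes (dn-up {c} {t} {t'}) = dist-opp {up c t} {dn c t'} up-dn
  ... | no ¬o = trans (dist-no (λ o → ¬o (opposite-mirror o))) (cong₂ ∣_-_∣ (height-mirror p) (height-mirror q))
    where
    height-mirror : ∀ p → height (mirror p) ≡ height p
    height-mirror (cut c)  = refl
    height-mirror (up c t) = refl
    height-mirror (dn c t) = refl

  offset-mono : ∀ {c c'} → c ≤ c' → offset c ≤ offset c'
  offset-mono {c} {zero}   z≤n = ≤-refl
  offset-mono {c} {suc c'} c≤c' with m≤n⇒m<n∨m≡n c≤c'
  ... | inj₂ refl       = ≤-refl
  ... | inj₁ (s≤s c≤c″) = ≤-trans (offset-mono c≤c″) (m≤m+n (offset c') (h c'))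

  offset-strict : ∀ {c c'} → c < c' → c' ≤ m → offset c < offset c'
  offset-strict {c} {c'} c<c' c'≤m =
    <-≤-trans (m<m+n (offset c) (≤-trans (s≤s z≤n) (h≥2 c (<-≤-trans c<c' c'≤m)))) (offset-mono c<c')

  offset-injective : ∀ {c c'} → c ≤ m → c' ≤ m → offset c ≡ offset c' → c ≡ c'
  offset-injective {c} {c'} c≤m c'≤m e with <-cmp c c'
  ... | tri< lt _ _ = ⊥-elim (<-irrefl e (offset-strict lt c'≤m))
  ... | tri≈ _ eq _ = eq
  ... | tri> _ _ gt = ⊥-elim (<-irrefl (sym e) (offset-strict gt c≤m))

  inner-not-cut : ∀ {c c' t} → c' ≤ m → 1 ≤ t → t < h c → offset c' ≢ offset c + t
  inner-not-cut {c} {c'} {t} c'≤m 1≤t t<h e with ≤-total c' c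
  ... | inj₁ c'≤c = <-irrefl refl (<-≤-trans (m<m+n (offset c) 1≤t) (≤-trans (≤-reflexive (sym e)) (offset-mono c'≤c)))
  ... | inj₂ c≤c' with m≤n⇒m<n∨m≡n c≤c'
  ...   | inj₂ refl = <-irrefl e (m<m+n (offset c) 1≤t)
  ...   | inj₁ c<c' = <-irrefl refl (<-≤-trans (+-monoʳ-< (offset c) t<h) (≤-trans (offset-mono c<c') (≤-reflexive e)))

  same-cycle : ∀ {c c' t t'} → t < h c → t' < h c' → offset c + t ≡ offset c' + t' → c ≡ c'
  same-cycle {c} {c'} {t} {t'} t<h t'<h e with <-cmp c c'
  ... | tri< lt _ _ = ⊥-elim (<-irrefl refl (<-≤-trans (+-monoʳ-< (offset c) t<h)
                        (≤-trans (offset-mono lt) (≤-trans (m≤m+n (offset c') t') (≤-reflexive (sym e))))))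
  ... | tri≈ _ eq _ = eq
  ... | tri> _ _ gt = ⊥-elim (<-irrefl refl (<-≤-trans (+-monoʳ-< (offset c') t'<h)
                        (≤-trans (offset-mono gt) (≤-trans (m≤m+n (offset c) t) (≤-reflexive e)))))

  height≤top : ∀ p → Valid p → height p ≤ offset m
  height≤top (cut c)  c≤m             = offset-mono c≤m
  height≤top (up c t) (c<m , _ , t<h) = ≤-trans (<⇒≤ (+-monoʳ-< (offset c) t<h)) (offset-mono c<m)
  height≤top (dn c t) (c<m , _ , t<h) = ≤-trans (<⇒≤ (+-monoʳ-< (offset c) t<h)) (offset-mono c<m)

  height-injective : ∀ p q → Valid p → Valid q → ¬ Opposite p q → height p ≡ height q → p ≡ q
  height-injective (cut c)  (cut c')   v           v'          _ e = cong cut (offset-injective v v' e)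
  height-injective (cut c)  (up c' t)  v           (_ , a , b) _ e = ⊥-elim (inner-not-cut v a b e)
  height-injective (cut c)  (dn c' t)  v           (_ , a , b) _ e = ⊥-elim (inner-not-cut v a b e)
  height-injective (up c t) (cut c')   (_ , a , b) v           _ e = ⊥-elim (inner-not-cut v a b (sym e))
  height-injective (dn c t) (cut c')   (_ , a , b) v           _ e = ⊥-elim (inner-not-cut v a b (sym e))
  height-injective (up c t) (up c' t') (_ , _ , b) (_ , _ , b') _ e with same-cycle b b' e
  ... | refl = cong (up c) (+-cancelˡ-≡ (offset c) _ _ e)
  height-injective (dn c t) (dn c' t') (_ , _ , b) (_ , _ , b') _ e with same-cycle b b' e
  ... | refl = cong (dn c) (+-cancelˡ-≡ (offset c) _ _ e)
  height-injective (up c t) (dn c' t') (_ , _ , b) (_ , _ , b') ¬o e with same-cycle b b' e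
  ... | refl = ⊥-elim (¬o up-dn)
  height-injective (dn c t) (up c' t') (_ , _ , b) (_ , _ , b') ¬o e with same-cycle b b' e
  ... | refl = ⊥-elim (¬o dn-up)

  arc-pos : ∀ x a b → 1 ≤ a → b < x → 0 < arc x a b
  arc-pos x a b 1≤a b<x = ⊓-glb (≤-trans 1≤a (m≤m+n a b)) (≤-trans (m<n⇒0<n∸m b<x) (m≤n+m (x ∸ b) (x ∸ a)))

  dist-zero : ∀ p q → Valid p → Valid q → dist p q ≡ 0 → p ≡ q
  dist-zero p q vp vq e with opposite? p q
  dist-zero (up c t) (dn c t') (_ , a , _) (_ , _ , b') e | yes up-dn =
    ⊥-elim (<-irrefl (sym e) (arc-pos (h c) t t' a b'))
  dist-zero (dn c t) (up c t') (_ , a , _) (_ , _ , b') e | yes dn-up =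
    ⊥-elim (<-irrefl (sym e) (arc-pos (h c) t t' a b'))
  ... | no ¬o = height-injective p q vp vq ¬o (∣m-n∣≡0⇒m≡n e)

  data Step : Pt → Pt → Set where
    up-up  : ∀ {c t} → c < m → 1 ≤ t → suc t < h c → Step (up c t) (up c (suc t))
    dn-dn  : ∀ {c t} → c < m → 1 ≤ t → suc t < h c → Step (dn c t) (dn c (suc t))
    cut-up : ∀ {c} → c < m → Step (cut c) (up c 1)
    cut-dn : ∀ {c} → c < m → Step (cut c) (dn c 1)
    up-cut : ∀ {c t} → c < m → 1 ≤ t → suc t ≡ h c → Step (up c t) (cut (suc c))
    dn-cut : ∀ {c t} → c < m → 1 ≤ t → suc t ≡ h c → Step (dn c t) (cut (suc c))

  step-height : ∀ {p q} → Step p q → height q ≡ suc (height p)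
  step-height (up-up {c} {t} _ _ _) = +-suc (offset c) t
  step-height (dn-dn {c} {t} _ _ _) = +-suc (offset c) t
  step-height (cut-up {c} _)        = +-comm (offset c) 1
  step-height (cut-dn {c} _)        = +-comm (offset c) 1
  step-height (up-cut {c} {t} _ _ e) = trans (cong (offset c +_) (sym e)) (+-suc (offset c) t)
  step-height (dn-cut {c} {t} _ _ e) = trans (cong (offset c +_) (sym e)) (+-suc (offset c) t)

  Lipschitz : Pt → Pt → Pt → Set
  Lipschitz p q z = dist p z ≤ suc (dist q z) × dist q z ≤ suc (dist p z)

  -- Away from opposite vertices dist is a height difference, hence Lipschitz.
  lipschitz-by-height : ∀ p q z → ¬ Opposite p z → ¬ Opposite q z → height q ≡ suc (height p) → Lipschitz p q z
  lipschitz-by-height p q z ¬o ¬o' e rewrite dist-no ¬o | dist-no ¬o' | e = ∣-∣-1-lipschitz (height p) (height z)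

  lipschitz-up-up : ∀ c t z → c < m → 1 ≤ t → suc t < h c → Lipschitz (up c t) (up c (suc t)) z
  lipschitz-up-up c t z c<m 1≤t st<h with opposite-or-not (up c t) z
  ... | inj₁ (up-dn {t' = t'}) rewrite dist-opp {up c t} {dn c t'} up-dn | dist-opp {up c (suc t)} {dn c t'} up-dn =
        ⊓-1-lipschitz (t + t') (suc t + t') (h c ∸ t + (h c ∸ t')) (h c ∸ suc t + (h c ∸ t')) refl
          (cong (_+ (h c ∸ t')) (∸-suc (h c) t (<-trans (n<1+n t) st<h)))
  ... | inj₂ ¬o = lipschitz-by-height (up c t) (up c (suc t)) z ¬o (λ { up-dn → ¬o up-dn }) (step-height (up-up c<m 1≤t st<h))

  lipschitz-cut-up : ∀ c z → c < m → Valid z → Lipschitz (cut c) (up c 1) z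
  lipschitz-cut-up c z c<m vz with opposite-or-not (up c 1) z
  ... | inj₁ (up-dn {t' = t'}) rewrite dist-opp {up c 1} {dn c t'} up-dn | dist-no {cut c} {dn c t'} (λ ())
                                    | ∣m-m+n∣≡n (offset c) t' =
        arc-from-start (h c) t' (proj₂ (proj₂ vz))
  ... | inj₂ ¬o = lipschitz-by-height (cut c) (up c 1) z (λ ()) ¬o (step-height (cut-up c<m))

  lipschitz-up-cut : ∀ c t z → c < m → 1 ≤ t → suc t ≡ h c → Valid z → Lipschitz (up c t) (cut (suc c)) z
  lipschitz-up-cut c t z c<m 1≤t e vz with opposite-or-not (up c t) z
  ... | inj₁ (up-dn {t' = t'}) rewrite dist-opp {up c t} {dn c t'} up-dn | dist-no {cut (suc c)} {dn c t'} (λ ())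
                                    | ∣m+n-m+o∣≡∣n-o∣ (offset c) (h c) t' | m≤n⇒∣n-m∣≡n∸m (<⇒≤ (proj₂ (proj₂ vz))) =
        arc-from-end (h c) t t' e (proj₂ (proj₂ vz))
  ... | inj₂ ¬o = lipschitz-by-height (up c t) (cut (suc c)) z ¬o (λ ()) (step-height (up-cut c<m 1≤t e))

  -- The lower-arc cases follow from the upper-arc ones by reflection.
  mirror-lipschitz : ∀ p q z → Lipschitz p q (mirror z) → Lipschitz (mirror p) (mirror q) z
  mirror-lipschitz p q z (l₁ , l₂) =
    subst₂ (λ a b → a ≤ suc b) (sym (swap p)) (sym (swap q)) l₁ ,
    subst₂ (λ a b → a ≤ suc b) (sym (swap q)) (sym (swap p)) l₂
    where
    swap : ∀ p → dist (mirror p) z ≡ dist p (mirror z)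
    swap p = trans (cong (dist (mirror p)) (sym (mirror-involutive z))) (dist-mirror p (mirror z))

  lipschitz : ∀ {p q} z → Valid z → Step p q → Lipschitz p q z
  lipschitz z vz (up-up c<m 1≤t st<h) = lipschitz-up-up _ _ z c<m 1≤t st<h
  lipschitz z vz (up-cut c<m 1≤t e)   = lipschitz-up-cut _ _ z c<m 1≤t e vz
  lipschitz z vz (cut-up c<m)         = lipschitz-cut-up _ z c<m vz
  lipschitz z vz (dn-dn {c} {t} c<m 1≤t st<h) =
    mirror-lipschitz (up c t) (up c (suc t)) z (lipschitz-up-up c t (mirror z) c<m 1≤t st<h)
  lipschitz z vz (dn-cut {c} {t} c<m 1≤t e) =
    mirror-lipschitz (up c t) (cut (suc c)) z (lipschitz-up-cut c t (mirror z) c<m 1≤t e (valid-mirror z vz))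
  lipschitz z vz (cut-dn {c} c<m) =
    mirror-lipschitz (cut c) (up c 1) z (lipschitz-cut-up c (mirror z) c<m (valid-mirror z vz))

  Closer : Pt → Pt → ℕ → Set
  Closer p q k = Σ Pt λ p' → Valid p' × (Step p p' ⊎ Step p' p) × dist p' q ≡ k

  step-mirror : ∀ {p q} → Step p q → Step (mirror p) (mirror q)
  step-mirror (up-up c<m a b)  = dn-dn c<m a b
  step-mirror (dn-dn c<m a b)  = up-up c<m a b
  step-mirror (cut-up c<m)     = cut-dn c<m
  step-mirror (cut-dn c<m)     = cut-up c<m
  step-mirror (up-cut c<m a e) = dn-cut c<m a e
  step-mirror (dn-cut c<m a e) = up-cut c<m a e

  mirror-closer : ∀ {p q k} → Closer p q k → Closer (mirror p) (mirror q) k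
  mirror-closer {q = q} (p' , vp' , step , e) =
    mirror p' , valid-mirror p' vp' , ⊎-map step-mirror step-mirror step , trans (dist-mirror p' q) e

  -- Two opposite vertices: walk along the arc of p towards the end of the
  -- cycle realising the minimum in arc.
  closer-opposite : ∀ c t t' k → Valid (up c t) → Valid (dn c t') → arc (h c) t t' ≡ suc k →
                    Closer (up c t) (dn c t') k
  closer-opposite c t t' k (c<m , 1≤t , t<h) (_ , _ , t'<h) e with (t + t') ≤? ((h c ∸ t) + (h c ∸ t'))
  closer-opposite c (suc zero) t' k (c<m , _ , _) _ e | yes le =
    cut c , <⇒≤ c<m , inj₂ (cut-up c<m) ,
    trans (dist-no {cut c} {dn c t'} (λ ())) (trans (∣m-m+n∣≡n (offset c) t') (cong pred (trans (sym (m≤n⇒m⊓n≡m le)) e)))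
  closer-opposite c (suc (suc t₀)) t' k (c<m , _ , t<h) _ e | yes le =
    up c (suc t₀) , (c<m , s≤s z≤n , <-trans (n<1+n _) t<h) , inj₂ (up-up c<m (s≤s z≤n) t<h) ,
    trans (dist-opp {up c (suc t₀)} {dn c t'} up-dn)
      (⊓-descend-left _ _ _ _ k refl (cong (_+ (h c ∸ t')) (∸-suc (h c) (suc t₀) (<-trans (n<1+n _) t<h))) le e)
  ... | no nle with suc t ≟ h c
  ...   | yes st≡h = cut (suc c) , c<m , inj₁ (up-cut c<m 1≤t st≡h) ,
          trans (dist-no {cut (suc c)} {dn c t'} (λ ())) (trans (∣m+n-m+o∣≡∣n-o∣ (offset c) (h c) t')
            (trans (m≤n⇒∣n-m∣≡n∸m (<⇒≤ t'<h))
              (cong pred (trans (cong (_+ (h c ∸ t')) (sym h∸t≡1)) (trans (sym (m≥n⇒m⊓n≡n (<⇒≤ (≰⇒> nle)))) e)))))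
    where
    h∸t≡1 : h c ∸ t ≡ 1
    h∸t≡1 = trans (cong (_∸ t) (sym st≡h)) (trans (cong (_∸ t) (+-comm 1 t)) (m+n∸m≡n t 1))
  ...   | no st≢h = up c (suc t) , (c<m , s≤s z≤n , st<h) , inj₁ (up-up c<m 1≤t st<h) ,
          trans (dist-opp {up c (suc t)} {dn c t'} up-dn)
            (⊓-descend-right _ _ _ _ k refl (cong (_+ (h c ∸ t')) (∸-suc (h c) t t<h)) (<⇒≤ (≰⇒> nle)) e)
    where
    st<h : suc t < h c
    st<h = ≤∧≢⇒< t<h st≢h

  approach-up : ∀ {p p' q k} → Step p p' → ¬ Opposite p q → ¬ Opposite p' q →
                height p < height q → dist p q ≡ suc k → dist p' q ≡ k
  approach-up {p} {p'} {q} {k} step ¬o ¬o' lt e =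
    trans (dist-no ¬o') (trans (cong (∣_- height q ∣) (step-height step))
      (∣-∣-step-up (height p) (height q) k lt (trans (sym (dist-no ¬o)) e)))

  approach-down : ∀ {p p' q k} → Step p' p → ¬ Opposite p q → ¬ Opposite p' q →
                  height q < height p → dist p q ≡ suc k → dist p' q ≡ k
  approach-down {p} {p'} {q} {k} step ¬o ¬o' lt e =
    trans (dist-no ¬o') (∣-∣-step-down (height p') (height q) k (subst (height q <_) (step-height step) lt)
      (trans (cong (∣_- height q ∣) (sym (step-height step))) (trans (sym (dist-no ¬o)) e)))

  -- q higher than p: step up; from a cut vertex, enter the arc not opposite to q.
  closer-upward : ∀ p q k → Valid p → Valid q → ¬ Opposite p q → height p < height q →
                  dist p q ≡ suc k → Closer p q k
  closer-upward (cut c) q k c≤m vq ¬o lt e with m≤n⇒m<n∨m≡n c≤m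
  ... | inj₂ refl = ⊥-elim (<-irrefl refl (<-≤-trans lt (height≤top q vq)))
  ... | inj₁ c<m with opposite-or-not (up c 1) q
  ...   | inj₁ up-dn = dn c 1 , (c<m , ≤-refl , h≥2 c c<m) , inj₁ (cut-dn c<m) ,
          approach-up (cut-dn c<m) ¬o (λ ()) lt e
  ...   | inj₂ ¬o' = up c 1 , (c<m , ≤-refl , h≥2 c c<m) , inj₁ (cut-up c<m) ,
          approach-up (cut-up c<m) ¬o ¬o' lt e
  closer-upward (up c t) q k (c<m , 1≤t , t<h) vq ¬o lt e with suc t ≟ h c
  ... | yes st≡h = cut (suc c) , c<m , inj₁ (up-cut c<m 1≤t st≡h) ,
        approach-up (up-cut c<m 1≤t st≡h) ¬o (λ ()) lt e
  ... | no st≢h = up c (suc t) , (c<m , s≤s z≤n , ≤∧≢⇒< t<h st≢h) , inj₁ (up-up c<m 1≤t (≤∧≢⇒< t<h st≢h)) ,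
        approach-up (up-up c<m 1≤t (≤∧≢⇒< t<h st≢h)) ¬o (λ { up-dn → ¬o up-dn }) lt e
  closer-upward (dn c t) q k (c<m , 1≤t , t<h) vq ¬o lt e with suc t ≟ h c
  ... | yes st≡h = cut (suc c) , c<m , inj₁ (dn-cut c<m 1≤t st≡h) ,
        approach-up (dn-cut c<m 1≤t st≡h) ¬o (λ ()) lt e
  ... | no st≢h = dn c (suc t) , (c<m , s≤s z≤n , ≤∧≢⇒< t<h st≢h) , inj₁ (dn-dn c<m 1≤t (≤∧≢⇒< t<h st≢h)) ,
        approach-up (dn-dn c<m 1≤t (≤∧≢⇒< t<h st≢h)) ¬o (λ { dn-up → ¬o dn-up }) lt e

  pred≥1 : ∀ {x} → 2 ≤ x → 1 ≤ pred x × suc (pred x) ≡ x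
  pred≥1 (s≤s (s≤s _)) = s≤s z≤n , refl

  -- q lower than p: step down; from a cut vertex, leave by the arc not opposite to q.
  closer-downward : ∀ p q k → Valid p → ¬ Opposite p q → height q < height p →
                    dist p q ≡ suc k → Closer p q k
  closer-downward (cut zero) q k _ ¬o () e
  closer-downward (cut (suc c)) q k c<m ¬o gt e = via-last (opposite-or-not (up c t) q)
    where
    t = pred (h c)
    1≤t : 1 ≤ t
    1≤t = proj₁ (pred≥1 (h≥2 c c<m))
    st≡h : suc t ≡ h c
    st≡h = proj₂ (pred≥1 (h≥2 c c<m))
    via-last : Opposite (up c t) q ⊎ ¬ Opposite (up c t) q → Closer (cut (suc c)) q k
    via-last (inj₁ up-dn) = dn c t , (c<m , 1≤t , ≤-reflexive st≡h) , inj₂ (dn-cut c<m 1≤t st≡h) ,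
                            approach-down (dn-cut c<m 1≤t st≡h) ¬o (λ ()) gt e
    via-last (inj₂ ¬o')   = up c t , (c<m , 1≤t , ≤-reflexive st≡h) , inj₂ (up-cut c<m 1≤t st≡h) ,
                            approach-down (up-cut c<m 1≤t st≡h) ¬o ¬o' gt e
  closer-downward (up c (suc zero)) q k (c<m , _ , _) ¬o gt e =
    cut c , <⇒≤ c<m , inj₂ (cut-up c<m) , approach-down (cut-up c<m) ¬o (λ ()) gt e
  closer-downward (up c (suc (suc t))) q k (c<m , _ , t<h) ¬o gt e =
    up c (suc t) , (c<m , s≤s z≤n , <-trans (n<1+n _) t<h) , inj₂ (up-up c<m (s≤s z≤n) t<h) ,
    approach-down (up-up c<m (s≤s z≤n) t<h) ¬o (λ { up-dn → ¬o up-dn }) gt e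
  closer-downward (dn c (suc zero)) q k (c<m , _ , _) ¬o gt e =
    cut c , <⇒≤ c<m , inj₂ (cut-dn c<m) , approach-down (cut-dn c<m) ¬o (λ ()) gt e
  closer-downward (dn c (suc (suc t))) q k (c<m , _ , t<h) ¬o gt e =
    dn c (suc t) , (c<m , s≤s z≤n , <-trans (n<1+n _) t<h) , inj₂ (dn-dn c<m (s≤s z≤n) t<h) ,
    approach-down (dn-dn c<m (s≤s z≤n) t<h) ¬o (λ { dn-up → ¬o dn-up }) gt e

  closer : ∀ p q k → Valid p → Valid q → dist p q ≡ suc k → Closer p q k
  closer p q k vp vq e with opposite-or-not p q
  ... | inj₁ (up-dn {c} {t} {t'}) = closer-opposite c t t' k vp vq (trans (sym (dist-opp {up c t} {dn c t'} up-dn)) e)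
  ... | inj₁ (dn-up {c} {t} {t'}) =
        mirror-closer (closer-opposite c t t' k vp vq (trans (sym (dist-opp {dn c t} {up c t'} dn-up)) e))
  ... | inj₂ ¬o with <-cmp (height p) (height q)
  ...   | tri< lt _ _ = closer-upward p q k vp vq ¬o lt e
  ...   | tri> _ _ gt = closer-downward p q k vp ¬o gt e
  ...   | tri≈ _ eq _ = ⊥-elim (0≢1+n (trans (sym (m≡n⇒∣m-n∣≡0 eq)) (trans (sym (dist-no ¬o)) e)))

  data Basis : Pt → Set where
    bottom : Basis (cut 0)
    upper  : ∀ {c t} → Valid (up c t) → Basis (up c t)

  dist-to-bottom : ∀ p → dist p (cut 0) ≡ height p
  dist-to-bottom p = trans (dist-no {p} {cut 0} (λ ())) (∣-∣-identityʳ (height p))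

  dist-from-bottom : ∀ p → dist (cut 0) p ≡ height p
  dist-from-bottom p = dist-no {cut 0} {p} (λ ())

  Separated : Pt → Pt → Pt → Set
  Separated w u v = (dist v u + dist u w ≡ dist v w) ⊎ (dist u v + dist v w ≡ dist u w)

  antipode-valid : ∀ c t → Valid (up c t) → Valid (up c (h c ∸ t))
  antipode-valid c t (c<m , 1≤t , t<h) = c<m , m<n⇒0<n∸m t<h , ∸-pos< (h c) t 1≤t t<h

  through-to-antipode : ∀ c a b → a < h c → b < h c →
    dist (dn c b) (up c a) + dist (up c a) (up c (h c ∸ b)) ≡ dist (dn c b) (up c (h c ∸ b))
  through-to-antipode c a b a<h b<h
    rewrite dist-opp {dn c b} {up c a} dn-up | dist-no {up c a} {up c (h c ∸ b)} (λ ())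
          | ∣m+n-m+o∣≡∣n-o∣ (offset c) a (h c ∸ b) | dist-opp {dn c b} {up c (h c ∸ b)} dn-up
          | arc-antipodal (h c) b (<⇒≤ b<h) = arc-through (h c) a b a<h b<h

  -- Every pair is separated by a basis vertex: the antipode of the lower
  -- vertex for opposite vertices, the bottom vertex otherwise.
  basis-separates : ∀ u v → Valid u → Valid v → Σ Pt λ w → Basis w × Separated w u v
  basis-separates u v vu vv with opposite-or-not u v
  basis-separates (up c t) (dn c t') (_ , _ , t<h) vv | inj₁ up-dn =
    up c (h c ∸ t') , upper (antipode-valid c t' vv) , inj₁ (through-to-antipode c t t' t<h (proj₂ (proj₂ vv)))
  basis-separates (dn c t) (up c t') vu (_ , _ , t'<h) | inj₁ dn-up =
    up c (h c ∸ t) , upper (antipode-valid c t vu) , inj₂ (through-to-antipode c t' t t'<h (proj₂ (proj₂ vu)))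
  ... | inj₂ ¬o with ≤-total (height u) (height v)
  ...   | inj₁ le = cut 0 , bottom , inj₁ (begin
          dist v u + dist u (cut 0)       ≡⟨ cong₂ _+_ (dist-no (λ o → ¬o (opposite-sym o))) (dist-to-bottom u) ⟩
          ∣ height v - height u ∣ + height u ≡⟨ cong (_+ height u) (m≤n⇒∣n-m∣≡n∸m le) ⟩
          height v ∸ height u + height u  ≡⟨ m∸n+n≡m le ⟩
          height v                        ≡⟨ sym (dist-to-bottom v) ⟩
          dist v (cut 0)                  ∎)
    where open ≡-Reasoning
  ...   | inj₂ le = cut 0 , bottom , inj₂ (begin
          dist u v + dist v (cut 0)       ≡⟨ cong₂ _+_ (dist-no ¬o) (dist-to-bottom v) ⟩
          ∣ height u - height v ∣ + height v ≡⟨ cong (_+ height v) (m≤n⇒∣n-m∣≡n∸m le) ⟩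
          height u ∸ height v + height v  ≡⟨ m∸n+n≡m le ⟩
          height u                        ≡⟨ sym (dist-to-bottom u) ⟩
          dist u (cut 0)                  ∎)
    where open ≡-Reasoning

  Beyond : Pt → Pt → Set
  Beyond p q = ∀ w → Valid w → dist q p + dist p w ≤ dist q w → w ≡ p

  short-of-antipode : ∀ c t → Valid (up c t) → ∀ w → Valid w →
                      w ≡ up c t ⊎ dist (dn c (h c ∸ t)) w < h c + dist (up c t) w
  short-of-antipode c t (c<m , 1≤t , t<h) w vw with opposite-or-not (dn c (h c ∸ t)) w
  short-of-antipode c t (c<m , 1≤t , t<h) (up c t'') (_ , _ , t''<h) | inj₁ dn-up with t ≟ t''
  ... | yes refl = inj₁ refl
  ... | no t≢t'' = inj₂ (subst₂ _<_
          (sym (dist-opp {dn c (h c ∸ t)} {up c t''} dn-up))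
          (cong (h c +_) (sym (trans (dist-no {up c t} {up c t''} (λ ())) (∣m+n-m+o∣≡∣n-o∣ (offset c) t t''))))
          (≤-<-trans (arc≤ (h c) (h c ∸ t) t'' (m∸n≤m (h c) t) (<⇒≤ t''<h)) (m<m+n (h c) (∣-∣-pos t t'' t≢t''))))
  short-of-antipode c t (c<m , 1≤t , t<h) w vw | inj₂ ¬ov with opposite-or-not (up c t) w
  short-of-antipode c t (c<m , 1≤t , t<h) (dn c t'') (_ , _ , t''<h) | inj₂ ¬ov | inj₁ up-dn =
    inj₂ (subst (_< h c + dist (up c t) (dn c t''))
           (sym (trans (dist-no ¬ov) (∣m+n-m+o∣≡∣n-o∣ (offset c) (h c ∸ t) t'')))
           (≤-trans (∣-∣<bound (h c ∸ t) t'' (h c) (∸-pos< (h c) t 1≤t t<h) t''<h) (m≤m+n (h c) _)))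
  ... | inj₂ ¬ou =
    inj₂ (subst₂ _<_ (sym (dist-no ¬ov)) (cong (h c +_) (sym (dist-no ¬ou)))
           (≤-<-trans (∣-∣-triangle (offset c + (h c ∸ t)) (offset c + t) (height w))
             (+-monoˡ-< ∣ offset c + t - height w ∣ antipodes-close)))
    where
    antipodes-close : ∣ offset c + (h c ∸ t) - (offset c + t) ∣ < h c
    antipodes-close = subst (_< h c) (sym (∣m+n-m+o∣≡∣n-o∣ (offset c) (h c ∸ t) t))
                        (∣-∣<bound (h c ∸ t) t (h c) (∸-pos< (h c) t 1≤t t<h) t<h)

  up-beyond-antipode : ∀ c t → Valid (up c t) → Beyond (up c t) (dn c (h c ∸ t))
  up-beyond-antipode c t vu w vw le with short-of-antipode c t vu w vw
  ... | inj₁ w≡u = w≡u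
  ... | inj₂ lt  = ⊥-elim (<-irrefl refl (<-≤-trans lt (≤-trans (≤-reflexive (cong (_+ dist (up c t) w) (sym antipodal))) le)))
    where
    antipodal : dist (dn c (h c ∸ t)) (up c t) ≡ h c
    antipodal = trans (dist-opp {dn c (h c ∸ t)} {up c t} dn-up)
                  (trans (arc-comm (h c) (h c ∸ t) t) (arc-antipodal (h c) t (<⇒≤ (proj₂ (proj₂ vu)))))

  mirror-beyond : ∀ {p q} → Beyond p q → Beyond (mirror p) (mirror q)
  mirror-beyond {p} {q} beyond w vw le =
    trans (sym (mirror-involutive w)) (cong mirror (beyond (mirror w) (valid-mirror w vw) le'))
    where
    swap : ∀ x → dist (mirror x) w ≡ dist x (mirror w)
    swap x = trans (cong (dist (mirror x)) (sym (mirror-involutive w))) (dist-mirror x (mirror w))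
    le' : dist q p + dist p (mirror w) ≤ dist q (mirror w)
    le' = subst₂ _≤_ (cong₂ _+_ (dist-mirror q p) (swap p)) (swap q) le

  antipode-beyond-up : ∀ c t → Valid (up c t) → Beyond (dn c (h c ∸ t)) (up c t)
  antipode-beyond-up c t vu =
    subst (λ s → Beyond (dn c (h c ∸ t)) (up c s)) (m∸[m∸n]≡n (<⇒≤ (proj₂ (proj₂ vu))))
      (mirror-beyond {up c (h c ∸ t)} {dn c (h c ∸ (h c ∸ t))} (up-beyond-antipode c (h c ∸ t) (antipode-valid c t vu)))

  dist-from-top : ∀ p → Valid p → dist (cut m) p ≡ offset m ∸ height p
  dist-from-top p vp = trans (dist-no {cut m} {p} (λ ())) (m≤n⇒∣n-m∣≡n∸m (height≤top p vp))

  bottom-beyond-top : Beyond (cut 0) (cut m)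
  bottom-beyond-top w vw le rewrite dist-to-bottom (cut m) | dist-from-bottom w | dist-from-top w vw =
    height-injective w (cut 0) vw z≤n (λ ())
      (n≤0⇒n≡0 (+-cancelˡ-≤ (offset m) (height w) 0
        (≤-trans le (≤-trans (m∸n≤m (offset m) (height w)) (≤-reflexive (sym (+-identityʳ (offset m))))))))

  top-beyond-bottom : Beyond (cut m) (cut 0)
  top-beyond-bottom w vw le rewrite dist-from-bottom (cut m) | dist-from-bottom w | dist-from-top w vw =
    height-injective w (cut m) vw ≤-refl (λ ()) (≤-antisym (height≤top w vw) (m+n≤o⇒m≤o (offset m) le))

-- The chain cycle with even cycle lengths n i ≥ 4 is an instance of the model
-- with h = n / 2: cycle i has raw positions 0 .. n i - 1, position 0 is the
-- cut vertex below it, position n i / 2 the cut vertex above it.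
module Chain (m : ℕ) (n : Fin m → ℕ) (even : (i : Fin m) → 2 ∣ n i) (n≥4 : (i : Fin m) → 4 ≤ n i) where

  -- Half the length of cycle c (0 when there is no such cycle), and its length.
  half : ℕ → ℕ
  half c with c <? m
  ... | yes c<m = n (fromℕ< c<m) / 2
  ... | no _    = 0

  half-toℕ : ∀ i → half (toℕ i) ≡ n i / 2
  half-toℕ i with toℕ i <? m
  ... | yes p = cong (λ j → n j / 2) (fromℕ<-toℕ i p)
  ... | no ¬p = ⊥-elim (¬p (toℕ<n i))

  perimeter : ℕ → ℕ
  perimeter c = half c + half c

  n≡half+half : ∀ i → n i ≡ n i / 2 + n i / 2
  n≡half+half i = trans (sym (m/n*n≡m (even i))) (trans (*-comm (n i / 2) 2) (cong (n i / 2 +_) (+-identityʳ (n i / 2))))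

  n≡perimeter : ∀ i → n i ≡ perimeter (toℕ i)
  n≡perimeter i = trans (n≡half+half i) (cong₂ _+_ (sym (half-toℕ i)) (sym (half-toℕ i)))

  half≥2 : ∀ c → c < m → 2 ≤ half c
  half≥2 c c<m with c <? m
  ... | no ¬c<m = ⊥-elim (¬c<m c<m)
  ... | yes c<m' = q+q≥4 _ (≤-trans (n≥4 (fromℕ< c<m')) (≤-reflexive (n≡half+half (fromℕ< c<m'))))
    where
    q+q≥4 : ∀ q → 4 ≤ q + q → 2 ≤ q
    q+q≥4 zero          ()
    q+q≥4 (suc zero)    (s≤s (s≤s ()))
    q+q≥4 (suc (suc q)) _ = s≤s (s≤s z≤n)

  open Model m half half≥2 public

  -- The model point of raw position a on cycle c: going up the upper arc
  -- for 0 < a < half c, and down the lower arc for a > half c.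
  positionBy : ∀ c a → Tri (a < half c) (a ≡ half c) (a > half c) → Pt
  positionBy c a (tri< _ _ _) = up c a
  positionBy c a (tri≈ _ _ _) = cut (suc c)
  positionBy c a (tri> _ _ _) = dn c (perimeter c ∸ a)

  position : ℕ → ℕ → Pt
  position c zero    = cut c
  position c (suc a) = positionBy c (suc a) (<-cmp (suc a) (half c))

  data PositionView (c a : ℕ) : Set where
    at-bottom : a ≡ 0 → position c a ≡ cut c → PositionView c a
    on-upper  : 0 < a → a < half c → position c a ≡ up c a → PositionView c a
    at-top    : 0 < a → a ≡ half c → position c a ≡ cut (suc c) → PositionView c a
    on-lower  : half c < a → position c a ≡ dn c (perimeter c ∸ a) → PositionView c a

  view : ∀ c a → PositionView c a
  view c zero = at-bottom refl refl
  view c (suc a) with <-cmp (suc a) (half c) in eq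
  ... | tri< lt _ _ = on-upper (s≤s z≤n) lt (cong (positionBy c (suc a)) eq)
  ... | tri≈ _ e _  = at-top (s≤s z≤n) e (cong (positionBy c (suc a)) eq)
  ... | tri> _ _ gt = on-lower gt (cong (positionBy c (suc a)) eq)

  half-pos : ∀ c → c < m → 0 < half c
  half-pos c c<m = ≤-trans (s≤s z≤n) (half≥2 c c<m)

  half<perimeter : ∀ c → c < m → half c < perimeter c
  half<perimeter c c<m = m<m+n (half c) (half-pos c c<m)

  position-up : ∀ c a → 0 < a → a < half c → position c a ≡ up c a
  position-up c a a>0 a<h with view c a
  ... | at-bottom refl _ = ⊥-elim (<-irrefl refl a>0)
  ... | on-upper _ _ e   = e
  ... | at-top _ a≡h _   = ⊥-elim (<-irrefl a≡h a<h)
  ... | on-lower h<a _   = ⊥-elim (<-asym a<h h<a)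

  position-top : ∀ c → c < m → position c (half c) ≡ cut (suc c)
  position-top c c<m with view c (half c)
  ... | at-bottom h≡0 _ = ⊥-elim (<-irrefl (sym h≡0) (half-pos c c<m))
  ... | on-upper _ lt _ = ⊥-elim (<-irrefl refl lt)
  ... | at-top _ _ e    = e
  ... | on-lower gt _   = ⊥-elim (<-irrefl refl gt)

  position-dn : ∀ c a → half c < a → position c a ≡ dn c (perimeter c ∸ a)
  position-dn c a h<a with view c a
  ... | at-bottom refl _ = ⊥-elim (<-irrefl refl (≤-<-trans z≤n h<a))
  ... | on-upper _ a<h _ = ⊥-elim (<-asym a<h h<a)
  ... | at-top _ a≡h _   = ⊥-elim (<-irrefl (sym a≡h) h<a)
  ... | on-lower _ e     = e

  h<perimeter∸t : ∀ x t → t < x → x < x + x ∸ t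
  h<perimeter∸t x t t<x = subst (x <_) (sym (+-∸-assoc x (<⇒≤ t<x))) (m<m+n x (m<n⇒0<n∸m t<x))

  position-lower : ∀ c t → c < m → t < half c → position c (perimeter c ∸ t) ≡ dn c t
  position-lower c t c<m t<h =
    trans (position-dn c (perimeter c ∸ t) (h<perimeter∸t (half c) t t<h))
          (cong (dn c) (m∸[m∸n]≡n (<⇒≤ (<-trans t<h (half<perimeter c c<m)))))

  perimeter∸a<half : ∀ x a → 0 < x → x < a → x + x ∸ a < x
  perimeter∸a<half x a x>0 x<a with ≤-total a (x + x)
  ... | inj₁ le = ≤-trans (∸-monoʳ-< x<a le) (≤-reflexive (m+n∸m≡n x x))
  ... | inj₂ ge = ≤-trans (≤-reflexive (cong suc (m≤n⇒m∸n≡0 ge))) x>0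

  position-valid : ∀ c a → c < m → a < perimeter c → Valid (position c a)
  position-valid c a c<m a<p with view c a
  ... | at-bottom _ e rewrite e = <⇒≤ c<m
  ... | on-upper a>0 a<h e rewrite e = c<m , a>0 , a<h
  ... | at-top _ _ e rewrite e = c<m
  ... | on-lower h<a e rewrite e = c<m , m<n⇒0<n∸m a<p , perimeter∸a<half (half c) a (half-pos c c<m) h<a

  toPt : CCV m n → Pt
  toPt base       = cut 0
  toPt (node i j) = position (toℕ i) (suc (toℕ j))

  node-position< : ∀ (i : Fin m) (j : Fin (n i ∸ 1)) → suc (toℕ j) < perimeter (toℕ i)
  node-position< i j = ≤-trans (<∸1⇒suc< (toℕ<n j)) (≤-reflexive (n≡perimeter i))

  toPt-valid : ∀ x → Valid (toPt x)
  toPt-valid base       = z≤n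
  toPt-valid (node i j) = position-valid (toℕ i) (suc (toℕ j)) (toℕ<n i) (node-position< i j)

  named-position : ∀ x i a → Named x i a → toPt x ≡ position (toℕ i) a
  named-position base i a (i≡0 , refl) = cong cut (sym i≡0)
  named-position (node i j) .i .(suc (toℕ j)) (inj₁ (refl , refl)) = refl
  named-position (node i j) i' .0 (inj₂ (i'≡ , refl , top)) =
    trans (subst (λ a → position (toℕ i) a ≡ cut (suc (toℕ i))) (sym (trans top (sym (half-toℕ i))))
            (position-top (toℕ i) (toℕ<n i)))
          (cong cut (sym i'≡))

  kind : Pt → ℕ
  kind (cut _)  = 0
  kind (up _ _) = 1
  kind (dn _ _) = 2

  kind-clash : ∀ {p q} → p ≡ q → kind p ≢ kind q → ∀ {A : Set} → A
  kind-clash e ne = ⊥-elim (ne (cong kind e))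

  cut-injective : ∀ {c c'} → cut c ≡ cut c' → c ≡ c'
  cut-injective refl = refl

  up-injective : ∀ {c t c' t'} → up c t ≡ up c' t' → c ≡ c' × t ≡ t'
  up-injective refl = refl , refl

  dn-injective : ∀ {c t c' t'} → dn c t ≡ dn c' t' → c ≡ c' × t ≡ t'
  dn-injective refl = refl , refl

  position-injective : ∀ c c' a a' → 0 < a → 0 < a' → a < perimeter c → a' < perimeter c' →
                       position c a ≡ position c' a' → c ≡ c' × a ≡ a'
  position-injective c c' a a' a>0 a'>0 a<p a'<p e with view c a | view c' a'
  ... | at-bottom refl _ | _ = ⊥-elim (<-irrefl refl a>0)
  ... | _ | at-bottom refl _ = ⊥-elim (<-irrefl refl a'>0)
  ... | on-upper _ _ e₁ | on-upper _ _ e₂ = up-injective (trans (sym e₁) (trans e e₂))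
  ... | on-upper _ _ e₁ | at-top _ _ e₂  = kind-clash (trans (sym e₁) (trans e e₂)) λ ()
  ... | on-upper _ _ e₁ | on-lower _ e₂  = kind-clash (trans (sym e₁) (trans e e₂)) λ ()
  ... | at-top _ _ e₁   | on-upper _ _ e₂ = kind-clash (trans (sym e₁) (trans e e₂)) λ ()
  ... | at-top _ _ e₁   | on-lower _ e₂  = kind-clash (trans (sym e₁) (trans e e₂)) λ ()
  ... | on-lower _ e₁   | on-upper _ _ e₂ = kind-clash (trans (sym e₁) (trans e e₂)) λ ()
  ... | on-lower _ e₁   | at-top _ _ e₂  = kind-clash (trans (sym e₁) (trans e e₂)) λ ()
  position-injective c c' a a' a>0 a'>0 a<p a'<p e | at-top _ q₁ e₁ | at-top _ q₂ e₂
    with cut-injective (trans (sym e₁) (trans e e₂))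
  ...   | refl = refl , trans q₁ (sym q₂)
  position-injective c c' a a' a>0 a'>0 a<p a'<p e | on-lower _ e₁ | on-lower _ e₂
    with dn-injective (trans (sym e₁) (trans e e₂))
  ...   | refl , eq = refl , ∸-injective (<⇒≤ a<p) (<⇒≤ a'<p) eq
    where
    ∸-injective : ∀ {x a a'} → a ≤ x → a' ≤ x → x ∸ a ≡ x ∸ a' → a ≡ a'
    ∸-injective {x} p q eq = trans (sym (m∸[m∸n]≡n p)) (trans (cong (x ∸_) eq) (m∸[m∸n]≡n q))

  position-named : ∀ x (i : Fin m) a → a < perimeter (toℕ i) → toPt x ≡ position (toℕ i) a → Named x i a
  position-named base i zero _ e = sym (cut-injective e) , refl
  position-named (node i' j) i zero _ e with view (toℕ i') (suc (toℕ j))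
  ... | on-upper _ _ e₁ = kind-clash (trans (sym e₁) e) λ ()
  ... | on-lower _ e₁   = kind-clash (trans (sym e₁) e) λ ()
  ... | at-top _ q e₁   = inj₂ (sym (cut-injective (trans (sym e₁) e)) , refl , trans q (half-toℕ i'))
  position-named base i (suc a) _ e with view (toℕ i) (suc a)
  ... | on-upper _ _ e₁ = kind-clash (trans e e₁) λ ()
  ... | on-lower _ e₁   = kind-clash (trans e e₁) λ ()
  ... | at-top _ _ e₁   = ⊥-elim (0≢1+n (cut-injective (trans e e₁)))
  position-named (node i' j) i (suc a) a<p e
    with position-injective (toℕ i') (toℕ i) (suc (toℕ j)) (suc a) (s≤s z≤n) (s≤s z≤n) (node-position< i' j) a<p e
  ... | i'≡i , j≡a = inj₁ (toℕ-injective i'≡i , sym j≡a)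

  toPt-injective : ∀ x y → toPt x ≡ toPt y → x ≡ y
  toPt-injective base base e = refl
  toPt-injective (node i j) base e with view (toℕ i) (suc (toℕ j))
  ... | on-upper _ _ e₁ = kind-clash (trans (sym e₁) e) λ ()
  ... | on-lower _ e₁   = kind-clash (trans (sym e₁) e) λ ()
  ... | at-top _ _ e₁   = ⊥-elim (0≢1+n (sym (cut-injective (trans (sym e₁) e))))
  toPt-injective x (node i j) e with x | position-named x i (suc (toℕ j)) (node-position< i j) e
  ... | base       | (_ , ())
  ... | node i' j' | inj₁ (refl , q) = cong (node i) (toℕ-injective (sym (suc-injective q)))
  ... | node i' j' | inj₂ (_ , () , _)

  node-at : ∀ c a → c < m → 0 < a → a < perimeter c → Σ (CCV m n) λ x → toPt x ≡ position c a
  node-at c (suc a) c<m _ a<p = node i j , cong₂ position (toℕ-fromℕ< c<m) (cong suc (toℕ-fromℕ< a<n∸1))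
    where
    i : Fin m
    i = fromℕ< c<m
    a<n∸1 : a < n i ∸ 1
    a<n∸1 = suc<⇒<∸1 (subst (suc a <_) (sym (trans (n≡perimeter i) (cong perimeter (toℕ-fromℕ< c<m)))) a<p)
    j : Fin (n i ∸ 1)
    j = fromℕ< a<n∸1

  toPt-surjective : ∀ p → Valid p → Σ (CCV m n) λ x → toPt x ≡ p
  toPt-surjective (cut zero) _ = base , refl
  toPt-surjective (cut (suc c)) c<m with node-at c (half c) c<m (half-pos c c<m) (half<perimeter c c<m)
  ... | x , e = x , trans e (position-top c c<m)
  toPt-surjective (up c t) (c<m , 1≤t , t<h) with node-at c t c<m 1≤t (<-trans t<h (half<perimeter c c<m))
  ... | x , e = x , trans e (position-up c t 1≤t t<h)
  toPt-surjective (dn c t) (c<m , 1≤t , t<h)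
    with node-at c (perimeter c ∸ t) c<m (m<n⇒0<n∸m t<p) (∸-pos< (perimeter c) t 1≤t t<p)
    where
    t<p : t < perimeter c
    t<p = <-trans t<h (half<perimeter c c<m)
  ... | x , e = x , trans e (position-lower c t c<m t<h)

  G : Graph
  G = ChainCycle m n

  adj-sym : ∀ x y → Adj G x y → Adj G y x
  adj-sym x y (i , a , b , Nx , Ny , a<n , b<n , cyc) = i , b , a , Ny , Nx , b<n , a<n , cyc-sym cyc
    where
    cyc-sym : ∀ {N a b} → CycAdj N a b → CycAdj N b a
    cyc-sym (inj₁ e)               = inj₂ (inj₁ e)
    cyc-sym (inj₂ (inj₁ e))        = inj₁ e
    cyc-sym (inj₂ (inj₂ (inj₁ e))) = inj₂ (inj₂ (inj₂ e))
    cyc-sym (inj₂ (inj₂ (inj₂ e))) = inj₂ (inj₂ (inj₁ e))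

  adjacent-positions : ∀ x y c a b → c < m → a < perimeter c → b < perimeter c →
                       toPt x ≡ position c a → toPt y ≡ position c b → CycAdj (perimeter c) a b → Adj G x y
  adjacent-positions x y c a b c<m a<p b<p ex ey cyc =
    i , a , b ,
    position-named x i a (subst (a <_) p≡ a<p) (subst (λ z → toPt x ≡ position z a) (sym ti) ex) ,
    position-named y i b (subst (b <_) p≡ b<p) (subst (λ z → toPt y ≡ position z b) (sym ti) ey) ,
    subst (a <_) p≡n a<p , subst (b <_) p≡n b<p , subst (λ z → CycAdj z a b) p≡n cyc
    where
    i : Fin m
    i = fromℕ< c<m
    ti : toℕ i ≡ c
    ti = toℕ-fromℕ< c<m
    p≡ : perimeter c ≡ perimeter (toℕ i)
    p≡ = cong perimeter (sym ti)
    p≡n : perimeter c ≡ n i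
    p≡n = trans p≡ (sym (n≡perimeter i))

  step⇒adj : ∀ {p q} → Step p q → ∀ x y → toPt x ≡ p → toPt y ≡ q → Adj G x y
  step⇒adj (up-up {c} {t} c<m 1≤t st<h) x y ex ey =
    adjacent-positions x y c t (suc t) c<m (<-trans (n<1+n t) st<p) st<p
      (trans ex (sym (position-up c t 1≤t (<-trans (n<1+n t) st<h))))
      (trans ey (sym (position-up c (suc t) (s≤s z≤n) st<h))) (inj₁ refl)
    where
    st<p = <-trans st<h (half<perimeter c c<m)
  step⇒adj (dn-dn {c} {t} c<m 1≤t st<h) x y ex ey =
    adjacent-positions x y c (perimeter c ∸ t) (perimeter c ∸ suc t) c<m
      (∸-pos< (perimeter c) t 1≤t t<p) (∸-pos< (perimeter c) (suc t) (s≤s z≤n) st<p)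
      (trans ex (sym (position-lower c t c<m (<-trans (n<1+n t) st<h))))
      (trans ey (sym (position-lower c (suc t) c<m st<h)))
      (inj₂ (inj₁ (sym (∸-suc (perimeter c) t t<p))))
    where
    st<p = <-trans st<h (half<perimeter c c<m)
    t<p = <-trans (n<1+n t) st<p
  step⇒adj (cut-up {c} c<m) x y ex ey =
    adjacent-positions x y c 0 1 c<m (≤-trans (s≤s z≤n) (half<perimeter c c<m))
      (≤-trans (half≥2 c c<m) (m≤m+n (half c) (half c)))
      ex (trans ey (sym (position-up c 1 (s≤s z≤n) (half≥2 c c<m)))) (inj₁ refl)
  step⇒adj (cut-dn {c} c<m) x y ex ey =
    adjacent-positions x y c 0 (perimeter c ∸ 1) c<m (≤-trans (s≤s z≤n) (half<perimeter c c<m))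
      (∸-pos< (perimeter c) 1 (s≤s z≤n) (<-trans (half≥2 c c<m) (half<perimeter c c<m)))
      ex (trans ey (sym (position-lower c 1 c<m (half≥2 c c<m))))
      (inj₂ (inj₂ (inj₂ (trans (+-comm 1 _) (m∸n+n≡m (≤-trans (s≤s z≤n) (half<perimeter c c<m))) , refl))))
  step⇒adj (up-cut {c} {t} c<m 1≤t st≡h) x y ex ey =
    adjacent-positions x y c t (half c) c<m (<-trans (≤-reflexive st≡h) (half<perimeter c c<m)) (half<perimeter c c<m)
      (trans ex (sym (position-up c t 1≤t (≤-reflexive st≡h)))) (trans ey (sym (position-top c c<m))) (inj₁ st≡h)
  step⇒adj (dn-cut {c} {t} c<m 1≤t st≡h) x y ex ey =
    adjacent-positions x y c (perimeter c ∸ t) (half c) c<m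
      (∸-pos< (perimeter c) t 1≤t (<-trans (≤-reflexive st≡h) (half<perimeter c c<m))) (half<perimeter c c<m)
      (trans ex (sym (position-lower c t c<m (≤-reflexive st≡h)))) (trans ey (sym (position-top c c<m)))
      (inj₂ (inj₁ (subst (λ z → suc z ≡ z + z ∸ t) st≡h (sym lower-end))))
    where
    lower-end : suc t + suc t ∸ t ≡ suc (suc t)
    lower-end = trans (+-∸-assoc (suc t) (n≤1+n t))
                  (trans (cong (suc t +_) (trans (cong (_∸ t) (+-comm 1 t)) (m+n∸m≡n t 1))) (+-comm (suc t) 1))

  Step± : Pt → Pt → Set
  Step± p q = Step p q ⊎ Step q p

  step±-sym : ∀ {p q} → Step± p q → Step± q p
  step±-sym (inj₁ s) = inj₂ s
  step±-sym (inj₂ s) = inj₁ s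

  step±-cong : ∀ {p p' q q'} → p ≡ p' → q ≡ q' → Step± p q → Step± p' q'
  step±-cong refl refl s = s

  consecutive-positions : ∀ c a → c < m → suc a < perimeter c → Step± (position c a) (position c (suc a))
  consecutive-positions c zero c<m _ = step±-cong refl (sym (position-up c 1 (s≤s z≤n) (half≥2 c c<m))) (inj₁ (cut-up c<m))
  consecutive-positions c (suc a) c<m ssa<p with view c (suc a) | view c (suc (suc a))
  ... | at-bottom () _ | _
  ... | _ | at-bottom () _
  ... | on-upper a>0 _ e₁ | on-upper _ lt e₂ = step±-cong (sym e₁) (sym e₂) (inj₁ (up-up c<m a>0 lt))
  ... | on-upper a>0 _ e₁ | at-top _ q e₂  = step±-cong (sym e₁) (sym e₂) (inj₁ (up-cut c<m a>0 q))
  ... | on-upper _ lt e₁ | on-lower gt _   = ⊥-elim (<-irrefl refl (<-≤-trans lt (≤-pred gt)))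
  ... | at-top _ q e₁ | on-upper _ lt _    = ⊥-elim (<-irrefl q (<-trans (n<1+n _) lt))
  ... | at-top _ q e₁ | at-top _ q' _      = ⊥-elim (<-irrefl q (≤-reflexive q'))
  ... | at-top _ q e₁ | on-lower _ e₂      = step±-cong (sym e₁) (sym e₂) (inj₂ (dn-cut c<m (m<n⇒0<n∸m ssa<p) last))
    where
    last : suc (perimeter c ∸ suc (suc a)) ≡ half c
    last = trans (sym (∸-suc (perimeter c) (suc a) (<-trans (n<1+n _) ssa<p)))
             (trans (cong (perimeter c ∸_) q) (m+n∸m≡n (half c) (half c)))
  ... | on-lower gt _ | on-upper _ lt _    = ⊥-elim (<-asym gt (<-trans (n<1+n _) lt))
  ... | on-lower gt _ | at-top _ q _       = ⊥-elim (<-irrefl (sym q) (<-trans gt (n<1+n _)))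
  ... | on-lower gt e₁ | on-lower _ e₂     =
    step±-cong (sym (trans e₁ (cong (dn c) p∸sa))) (sym e₂) (inj₂ (dn-dn c<m (m<n⇒0<n∸m ssa<p) below-half))
    where
    p∸sa : perimeter c ∸ suc a ≡ suc (perimeter c ∸ suc (suc a))
    p∸sa = ∸-suc (perimeter c) (suc a) (<-trans (n<1+n _) ssa<p)
    below-half : suc (perimeter c ∸ suc (suc a)) < half c
    below-half = subst (_< half c) p∸sa (perimeter∸a<half (half c) (suc a) (half-pos c c<m) gt)

  cyclic-positions : ∀ c a b → c < m → a < perimeter c → b < perimeter c →
                     CycAdj (perimeter c) a b → Step± (position c a) (position c b)
  cyclic-positions c a .(suc a) c<m _ sa<p (inj₁ refl) = consecutive-positions c a c<m sa<p
  cyclic-positions c .(suc b) b c<m sb<p _ (inj₂ (inj₁ refl)) = step±-sym (consecutive-positions c b c<m sb<p)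
  cyclic-positions c a .0 c<m a<p _ (inj₂ (inj₂ (inj₁ (sa≡p , refl)))) =
    step±-cong (sym (trans (position-dn c a h<a) (cong (dn c) p∸a≡1))) refl (inj₂ (cut-dn c<m))
    where
    a≡ : a ≡ perimeter c ∸ 1
    a≡ = sym (trans (cong (_∸ 1) (sym sa≡p)) (trans (cong (_∸ 1) (+-comm 1 a)) (m+n∸n≡m a 1)))
    h<a : half c < a
    h<a = subst (half c <_) (sym a≡) (h<perimeter∸t (half c) 1 (half≥2 c c<m))
    p∸a≡1 : perimeter c ∸ a ≡ 1
    p∸a≡1 = trans (cong (perimeter c ∸_) a≡) (m∸[m∸n]≡n (≤-trans (s≤s z≤n) (half<perimeter c c<m)))
  cyclic-positions c .0 b c<m a<p b<p (inj₂ (inj₂ (inj₂ (sb≡p , refl)))) =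
    step±-sym (cyclic-positions c b 0 c<m b<p a<p (inj₂ (inj₂ (inj₁ (sb≡p , refl)))))

  adj⇒step : ∀ x y → Adj G x y → Step± (toPt x) (toPt y)
  adj⇒step x y (i , a , b , Nx , Ny , a<n , b<n , cyc) =
    step±-cong (sym (named-position x i a Nx)) (sym (named-position y i b Ny))
      (cyclic-positions (toℕ i) a b (toℕ<n i) (subst (a <_) (n≡perimeter i) a<n) (subst (b <_) (n≡perimeter i) b<n)
        (subst (λ z → CycAdj z a b) (n≡perimeter i) cyc))

  δ : CCV m n → CCV m n → ℕ
  δ x y = dist (toPt x) (toPt y)

  δ-zero : ∀ x y → δ x y ≡ 0 → x ≡ y
  δ-zero x y e = toPt-injective x y (dist-zero (toPt x) (toPt y) (toPt-valid x) (toPt-valid y) e)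

  δ-step : ∀ {x y} z → Adj G x y → δ x z ≤ suc (δ y z)
  δ-step {x} {y} z xy with adj⇒step x y xy
  ... | inj₁ s = proj₁ (lipschitz (toPt z) (toPt-valid z) s)
  ... | inj₂ s = proj₂ (lipschitz (toPt z) (toPt-valid z) s)

  δ-descent : ∀ x z k → δ x z ≡ suc k → Σ (CCV m n) λ y → Adj G x y × δ y z ≡ k
  δ-descent x z k e with closer (toPt x) (toPt z) k (toPt-valid x) (toPt-valid z) e
  ... | p , vp , step , e' with toPt-surjective p vp
  ...   | y , ey = y , edge step , trans (cong (λ q → dist q (toPt z)) ey) e'
    where
    edge : Step± (toPt x) p → Adj G x y
    edge (inj₁ s) = step⇒adj s x y refl ey
    edge (inj₂ s) = adj-sym y x (step⇒adj s y x ey refl)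

  open Geodesics G δ (λ x → dist-refl (toPt x)) δ-zero δ-step δ-descent public

module Basis (m : ℕ) (m≥1 : 1 ≤ m) (n : Fin m → ℕ) (even : (i : Fin m) → 2 ∣ n i) (n≥4 : (i : Fin m) → 4 ≤ n i) where

  open Chain m n even n≥4

  upperArc : ℕ → List Pt
  upperArc c = map (λ t → up c (suc t)) (upTo (half c ∸ 1))

  arcs : List (List Pt)
  arcs = tabulate {n = m} (λ i → upperArc (toℕ i))

  basisPts : List Pt
  basisPts = cut 0 ∷ concat arcs

  upperArc-sound : ∀ {c p} → c < m → p ∈ upperArc c → Σ ℕ λ t → p ≡ up c t × Valid (up c t)
  upperArc-sound {c} c<m p∈ with ∈-map⁻ (λ t → up c (suc t)) p∈
  ... | t , t∈ , refl = suc t , refl , (c<m , s≤s z≤n , <∸1⇒suc< (∈-upTo⁻ t∈))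

  arcs-upper : ∀ {p} → p ∈ concat arcs →
               Σ ℕ λ c → Σ ℕ λ t → p ≡ up c t × Valid (up c t)
  arcs-upper {p} p∈ with ∈-concat⁻′ arcs p∈
  ... | xs , p∈xs , xs∈ with ∈-tabulate⁻ {f = λ i → upperArc (toℕ i)} xs∈
  ...   | i , xs≡ with upperArc-sound (toℕ<n i) (subst (p ∈_) xs≡ p∈xs)
  ...     | t , p≡ , v = toℕ i , t , p≡ , v

  basisPts-sound : ∀ {p} → p ∈ basisPts → Basis p
  basisPts-sound (here refl) = bottom
  basisPts-sound (there p∈) with arcs-upper p∈
  ... | c , t , refl , v = upper v

  basisPts-complete : ∀ {p} → Basis p → p ∈ basisPts
  basisPts-complete bottom = here refl
  basisPts-complete (upper {c} {suc t} (c<m , _ , st<h)) =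
    there (∈-concat⁺′ (∈-map⁺ (λ t → up c (suc t)) (∈-upTo⁺ (suc<⇒<∸1 st<h)))
      (subst (λ z → upperArc z ∈ arcs) (toℕ-fromℕ< c<m) (∈-tabulate⁺ (fromℕ< c<m))))

  basisPts-unique : Unique basisPts
  basisPts-unique =
    All.tabulate (λ p∈ 0≡p → bottom≢up (arcs-upper p∈) 0≡p) ∷
    UniqueP.concat⁺ (AllP.tabulate⁺ (λ i → UniqueP.map⁺ up-suc-injective (UniqueP.upTo⁺ _)))
                    (AllPairsP.tabulate⁺ λ i≢j (p∈i , p∈j) → i≢j (same-arc p∈i p∈j))
    where
    bottom≢up : ∀ {p} → Σ ℕ (λ c → Σ ℕ λ t → p ≡ up c t × Valid (up c t)) → cut 0 ≢ p
    bottom≢up (c , t , refl , _) ()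
    up-suc-injective : ∀ {c x y} → up c (suc x) ≡ up c (suc y) → x ≡ y
    up-suc-injective refl = refl
    same-arc : ∀ {i j p} → p ∈ upperArc (toℕ i) → p ∈ upperArc (toℕ j) → i ≡ j
    same-arc {i} {j} p∈i p∈j with upperArc-sound (toℕ<n i) p∈i | upperArc-sound (toℕ<n j) p∈j
    ... | _ , p≡i , _ | _ , p≡j , _ = toℕ-injective (proj₁ (up-injective (trans (sym p≡i) p≡j)))

  [q+q∸2]/2 : ∀ q → (q + q ∸ 2) / 2 ≡ q ∸ 1
  [q+q∸2]/2 zero    = refl
  [q+q∸2]/2 (suc q) = trans (cong (_/ 2) (trans (cong (_∸ 1) (+-suc q q)) q+q≡q*2)) (m*n/n≡m q 2)
    where
    q+q≡q*2 : q + q ≡ q * 2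
    q+q≡q*2 = trans (cong (q +_) (sym (+-identityʳ q))) (*-comm 2 q)

  basisPts-length : length basisPts ≡ 1 + sum (tabulate (λ i → (n i ∸ 2) / 2))
  basisPts-length = cong suc (begin
    length (concat arcs)                                   ≡⟨ length-concat arcs ⟩
    sum (map length arcs)                                  ≡⟨ cong sum (map-tabulate {n = m} (λ i → upperArc (toℕ i)) length) ⟩
    sum (tabulate {n = m} λ i → length (upperArc (toℕ i))) ≡⟨ cong sum (tabulate-cong {n = m} arc-length) ⟩
    sum (tabulate λ i → (n i ∸ 2) / 2)                     ∎)
    where
    open ≡-Reasoning
    arc-length : ∀ i → length (upperArc (toℕ i)) ≡ (n i ∸ 2) / 2
    arc-length i = trans (length-map _ (upTo (half (toℕ i) ∸ 1)))
                     (trans (length-upTo (half (toℕ i) ∸ 1)) (sym (trans (cong (λ z → (z ∸ 2) / 2) (n≡perimeter i)) ([q+q∸2]/2 (half (toℕ i))))))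

  basis-valid : ∀ {p} → Basis p → Valid p
  basis-valid bottom    = z≤n
  basis-valid (upper v) = v

  vertexOf : ∀ {p} → p ∈ basisPts → CCV m n
  vertexOf {p} p∈ = proj₁ (toPt-surjective p (basis-valid (basisPts-sound p∈)))

  basis : List (CCV m n)
  basis = mapWith∈ basisPts vertexOf

  basis-coordinates : map toPt basis ≡ basisPts
  basis-coordinates =
    trans (map-mapWith∈ basisPts vertexOf toPt)
      (trans (mapWith∈-cong basisPts _ (λ {p} _ → p) (λ {p} p∈ → proj₂ (toPt-surjective p (basis-valid (basisPts-sound p∈)))))
        (mapWith∈-id basisPts))

  basis-unique : Unique basis
  basis-unique = UniqueP.map⁻ (subst Unique (sym basis-coordinates) basisPts-unique)

  basis-length : length basis ≡ 1 + sum (tabulate (λ i → (n i ∸ 2) / 2))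
  basis-length = trans (sym (length-map toPt basis)) (trans (cong length basis-coordinates) basisPts-length)

  basis-resolving : IsStrongResolvingSet G basis
  basis-resolving u v _ with basis-separates (toPt u) (toPt v) (toPt-valid u) (toPt-valid v)
  ... | p , bp , sep with ∈-map⁻ toPt (subst (p ∈_) (sym basis-coordinates) (basisPts-complete bp))
  ...   | w , w∈ , p≡ = w , w∈ , resolves (subst (λ q → Separated q (toPt u) (toPt v)) p≡ sep)
    where
    resolves : Separated (toPt w) (toPt u) (toPt v) → StronglyResolves G w u v
    resolves (inj₁ e) = inj₁ (between⇒onShortest u v w e)
    resolves (inj₂ e) = inj₂ (between⇒onShortest v u w e)

  -- Lower bound.  Every basis point p has a partner such that the two are
  -- mutually maximally distant and both sit at level height p; distinct basis
  -- points have distinct heights.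
  partner : Pt → Pt
  partner (up c t) = dn c (half c ∸ t)
  partner _        = cut m

  -- The level of an upper point is its height, that of a lower point the height
  -- of its antipode; the level of a cut vertex is 0.
  level : Pt → ℕ
  level (cut _)  = 0
  level (up c t) = offset c + t
  level (dn c t) = offset c + (half c ∸ t)

  record Antipodes (p : Pt) : Set where
    field
      partner-valid : Valid (partner p)
      distinct      : p ≢ partner p
      beyond-p      : Beyond p (partner p)
      beyond-q      : Beyond (partner p) p
      level-p       : level p ≡ height p
      level-q       : level (partner p) ≡ height p

  antipodes : ∀ {p} → Basis p → Antipodes p
  antipodes bottom = record
    { partner-valid = ≤-refl
    ; distinct      = λ 0≡m → <-irrefl (cut-injective 0≡m) m≥1
    ; beyond-p      = bottom-beyond-top
    ; beyond-q      = top-beyond-bottom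
    ; level-p       = refl
    ; level-q       = refl
    }
  antipodes (upper {c} {t} v) = record
    { partner-valid = antipode-valid c t v
    ; distinct      = λ ()
    ; beyond-p      = up-beyond-antipode c t v
    ; beyond-q      = antipode-beyond-up c t v
    ; level-p       = refl
    ; level-q       = cong (offset c +_) (m∸[m∸n]≡n (<⇒≤ (proj₂ (proj₂ v))))
    }

  mutually-maximal : ∀ {u v} → Beyond (toPt u) (toPt v) → Beyond (toPt v) (toPt u) → MutuallyMaximal u v
  mutually-maximal {u} {v} beyond-u beyond-v =
    (λ w le → toPt-injective w u (beyond-u (toPt w) (toPt-valid w) le)) ,
    (λ w le → toPt-injective w v (beyond-v (toPt w) (toPt-valid w) le))

  open Antipodes

  pair-hit : ∀ W → IsStrongResolvingSet G W → ∀ u v → Antipodes (toPt u) → toPt v ≡ partner (toPt u) →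
             u ∈ W ⊎ v ∈ W
  pair-hit W resolving u v a v↦ =
    resolving-set-meets W
      (mutually-maximal (subst (Beyond (toPt u)) (sym v↦) (beyond-p a)) (subst (λ q → Beyond q (toPt u)) (sym v↦) (beyond-q a)))
      (λ u≡v → distinct a (trans (cong toPt u≡v) v↦)) resolving

  level-hit : ∀ W → IsStrongResolvingSet G W → ∀ {p} → Basis p →
              Σ (CCV m n) λ x → x ∈ W × level (toPt x) ≡ height p
  level-hit W resolving {p} bp with toPt-surjective p (basis-valid bp) | toPt-surjective (partner p) (partner-valid (antipodes bp))
  ... | u , refl | v , v↦ with pair-hit W resolving u v (antipodes bp) v↦
  ...   | inj₁ u∈W = u , u∈W , level-p (antipodes bp)
  ...   | inj₂ v∈W = v , v∈W , trans (cong level v↦) (level-q (antipodes bp))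

  heights-unique : Unique (map height basisPts)
  heights-unique = unique-map-injectiveOn height (All.tabulate basisPts-sound)
    (λ bp bq → height-injective _ _ (basis-valid bp) (basis-valid bq) (not-opposite bp bq)) basisPts-unique
    where
    not-opposite : ∀ {p q} → Basis p → Basis q → ¬ Opposite p q
    not-opposite bottom    _         ()
    not-opposite (upper _) bottom    ()
    not-opposite (upper _) (upper _) ()

  lower-bound : ∀ W → IsStrongResolvingSet G W → length basisPts ≤ length W
  lower-bound W resolving = begin
    length basisPts                  ≡⟨ length-map height basisPts ⟨
    length (map height basisPts)     ≤⟨ unique-length-≤ _ _ heights-unique levels-hit ⟩
    length (map (level ∘ toPt) W)    ≡⟨ length-map (level ∘ toPt) W ⟩
    length W                         ∎
    where
    open ≤-Reasoning
    levels-hit : ∀ {k} → k ∈ map height basisPts → k ∈ map (level ∘ toPt) W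
    levels-hit k∈ with ∈-map⁻ height k∈
    ... | p , p∈ , refl with level-hit W resolving (basisPts-sound p∈)
    ...   | x , x∈W , lx = subst (_∈ map (level ∘ toPt) W) lx (∈-map⁺ (level ∘ toPt) x∈W)

theorem3p5 : (m : ℕ) → 1 ≤ m → (n : Fin m → ℕ) →
    ((i : Fin m) → 2 ∣ n i) → ((i : Fin m) → 4 ≤ n i) →
    IsSDim (ChainCycle m n) (1 + sum (tabulate (λ i → (n i ∸ 2) / 2)))
theorem3p5 m m≥1 n even n≥4 =
  (basis , basis-unique , basis-resolving , basis-length) ,
  λ W _ resolving → subst (_≤ length W) basisPts-length (lower-bound W resolving)
  where open Basis m m≥1 n even n≥4
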